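{- Let $r\geq 3$ and $\varepsilon>0$, and let $G=(V,E)$ be a maximal $K_r$-free graph with $\delta(G)\geq\left(\frac{2r-5}{2r-3}+\varepsilon\right)|V|$. If two distinct vertices $u,v\in V$ are non-adjacent in $G$ and $U\subseteq V$ satisfies $|U|<\varepsilon|V|$, then the induced subgraph $G[(N(u)\cap N(v))\setminus U]$ contains a copy of $K_{r-2}$.
   Context: All graphs are finite, simple, undirected and loopless. $K_s$ is the complete graph on $s$ vertices (so $K_1$ is a single vertex). $G$ is $K_r$-free if it contains no copy of $K_r$, and maximal $K_r$-free if it is $K_r$-free and adding any non-edge creates a copy of $K_r$. $N(v)$ is the set of neighbours of $v$, $\delta(G)$ is the minimum degree, and $G[W]$ is the subgraph induced on $W$.
   Formalization: The parameter ε ranges over the positive rationals. -}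

module Defs where

open import Data.Nat using (ℕ; _+_; _*_; _∸_; _≤_; _<_)
open import Data.Bool using (Bool; true; false; _∨_; _∧_)
open import Data.Fin using (Fin; _≟_)
open import Data.Fin.Subset using (Subset; _∉_)
open import Data.List using (List; length; filter)
open import Data.List using () renaming (allFin to allFinL)
open import Data.Bool.Properties using (T?)
open import Data.Product using (Σ; _×_)
open import Relation.Nullary using (¬_; does)
open import Relation.Binary.PropositionalEquality using (_≡_; _≢_)
open import Function.Definitions using (Injective)

record Graph (n : ℕ) : Set where
  field
    adj   : Fin n → Fin n → Bool
    sym   : ∀ u v → adj u v ≡ adj v u
    irrefl : ∀ v → adj v v ≡ false
open Graph public

degree : ∀ {n} → Graph n → Fin n → ℕ
degree {n} G v = length (filter (λ w → T? (adj G v w)) (allFinL n))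

MinDegreeAtLeast : ∀ {n} → Graph n → ℕ → Set
MinDegreeAtLeast G d = ∀ v → d ≤ degree G v

-- A copy of K_s in G whose vertices all satisfy the predicate W
-- (i.e. a copy of K_s in the induced subgraph G[W]):
-- an injective map Fin s → Fin n whose images are pairwise adjacent.
record CliqueIn {n} (G : Graph n) (W : Fin n → Set) (s : ℕ) : Set where
  field
    f     : Fin s → Fin n
    inj   : Injective _≡_ _≡_ f
    adjac : ∀ i j → i ≢ j → adj G (f i) (f j) ≡ true
    inW   : ∀ i → W (f i)

HasClique : ∀ {n} → Graph n → ℕ → Set
HasClique G s = CliqueIn G (λ _ → ⊤') s
  where
  open import Data.Unit using () renaming (⊤ to ⊤')

KFree : ∀ {n} → ℕ → Graph n → Set
KFree r G = ¬ HasClique G r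

addEdge : ∀ {n} (G : Graph n) (u v : Fin n) → u ≢ v → Graph n
addEdge {n} G u v u≢v = record { adj = a ; sym = s ; irrefl = i }
  where
  isE : Fin n → Fin n → Bool
  isE x y = (does (x ≟ u) ∧ does (y ≟ v)) ∨ (does (x ≟ v) ∧ does (y ≟ u))
  a : Fin n → Fin n → Bool
  a x y = adj G x y ∨ isE x y
  open import Relation.Nullary using (yes; no)
  open import Relation.Binary.PropositionalEquality using (refl; trans; cong; cong₂)
  open import Data.Bool.Properties using (∨-comm)
  isE-sym : ∀ x y → isE x y ≡ isE y x
  isE-sym x y = trans (cong₂ _∨_ (∧c (does (x ≟ u)) (does (y ≟ v))) (∧c (does (x ≟ v)) (does (y ≟ u))))
                      (∨-comm (does (y ≟ v) ∧ does (x ≟ u)) (does (y ≟ u) ∧ does (x ≟ v)))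
    where
    open import Data.Bool.Properties using () renaming (∧-comm to ∧c)
  s : ∀ x y → a x y ≡ a y x
  s x y = cong₂ _∨_ (sym G x y) (isE-sym x y)
  i : ∀ x → a x x ≡ false
  i x with x ≟ u | x ≟ v
  ... | yes refl | yes refl = ⊥-elim (u≢v refl)
    where open import Data.Empty using (⊥-elim)
  ... | yes refl | no _ = trans (cong (_∨ false) (irrefl G x)) refl
  ... | no _ | yes refl = trans (cong (_∨ false) (irrefl G x)) refl
  ... | no _ | no _ = trans (cong (_∨ false) (irrefl G x)) refl

MaximalKFree : ∀ {n} → ℕ → Graph n → Set
MaximalKFree r G = KFree r G ×
  (∀ u v (u≢v : u ≢ v) → adj G u v ≡ false → HasClique (addEdge G u v u≢v) r)

-- Adding the non-edge uv to G creates a K_r through u and v, so u and v have r − 2 pairwise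
-- adjacent common neighbours. While one of them lies in U, replace it by a common neighbour
-- outside U adjacent to the other r − 3; this lowers the number of clique vertices in U.
-- If no replacement exists although some clique vertex lies in U, weight each clique vertex
-- 1 if it lies in U and 2 otherwise; the total weight B is then at most 2r − 5. Every vertex
-- w has at most B + [w ∈ U] neighbours among u, v and the weighted clique, and summing over w
-- against the minimum degree gives (2 + B)·δ ≤ |V|·B + |U|, contradicting the bounds on δ
-- and |U|.

module Submission where

open import Data.Bool using (Bool; true; false; _∨_; if_then_else_)
open import Data.Bool.Properties using (T?; ∨-identityʳ; ∧-zeroʳ; ¬-not) renaming (_≟_ to _≟ᵇ_)
open import Data.Empty using (⊥-elim)
open import Data.Fin using (Fin; zero; suc; _≟_; punchIn; punchOut)
open import Data.Fin.Properties using (any?; all?; punchIn-injective; punchInᵢ≢i; punchIn-punchOut)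
open import Data.Fin.Subset using (Subset; _∈_; _∉_; ∣_∣; inside; outside)
open import Data.Fin.Subset.Properties using (_∈?_)
open import Data.List using (length; filter; tabulate)
open import Data.Nat using (ℕ; zero; suc; _+_; _*_; _∸_; _≤_; _<_; z≤n; s≤s; s≤s⁻¹)
open import Data.Nat.Properties hiding (_≟_)
open import Algebra.Properties.Semiring.Sum +-*-semiring
  using (sum; sum-syntax; sum-remove; sum-cong-≗; ∑-distrib-+; ∑-comm; *-distribˡ-sum)
open import Data.Nat.Tactic.RingSolver using (solve-∀)
open import Data.Product using (∃; ∃₂; _×_; _,_; proj₁; proj₂)
open import Data.Unit using (tt)
open import Data.Vec using ([]; _∷_)
open import Data.Vec.Functional using (removeAt)
open import Function using (_∘_)
open import Relation.Nullary using (Dec; yes; no; does; ¬_; ¬?)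
open import Relation.Nullary.Decidable using (_×-dec_; dec-true; dec-false)
open import Relation.Binary.PropositionalEquality
open import Defs hiding (sym)

open CliqueIn using (inj; adjac; inW) renaming (f to vertex)

𝟙 : Bool → ℕ
𝟙 true  = 1
𝟙 false = 0

𝟙≤1 : ∀ b → 𝟙 b ≤ 1
𝟙≤1 true  = ≤-refl
𝟙≤1 false = z≤n

*𝟙≤ : ∀ c b → c * 𝟙 b ≤ c
*𝟙≤ c b = ≤-trans (*-monoʳ-≤ c (𝟙≤1 b)) (≤-reflexive (*-identityʳ c))

*𝟙-false : ∀ c {b} → b ≡ false → c * 𝟙 b + c ≤ c
*𝟙-false c refl = ≤-reflexive (cong (_+ c) (*-zeroʳ c))

∑-mono-≤ : ∀ {m} {f g : Fin m → ℕ} → (∀ i → f i ≤ g i) → sum f ≤ sum g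
∑-mono-≤ {zero}  _   = z≤n
∑-mono-≤ {suc m} f≤g = +-mono-≤ (f≤g zero) (∑-mono-≤ (f≤g ∘ suc))

∑-const : ∀ m c → ∑[ i < m ] c ≡ m * c
∑-const zero    c = refl
∑-const (suc m) c = cong (c +_) (∑-const m c)

∑-pick : ∀ {m} {f g : Fin m → ℕ} {i d} → (∀ j → f j ≤ g j) → f i + d ≤ g i → sum f + d ≤ sum g
∑-pick {suc m} {f} {g} {i} {d} f≤g slack = begin
  sum f + d                     ≡⟨ cong (_+ d) (sum-remove f) ⟩
  f i + sum (removeAt f i) + d  ≡⟨ rearrange (f i) _ d ⟩
  f i + d + sum (removeAt f i)  ≤⟨ +-mono-≤ slack (∑-mono-≤ (f≤g ∘ punchIn i)) ⟩
  g i + sum (removeAt g i)      ≡⟨ sym (sum-remove g) ⟩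
  sum g                         ∎
  where
  open ≤-Reasoning
  rearrange : ∀ a s d → a + s + d ≡ a + d + s
  rearrange = solve-∀

∑-pick₂ : ∀ {m} {f g : Fin m → ℕ} {i j d e} → i ≢ j → (∀ k → f k ≤ g k) →
  f i + d ≤ g i → f j + e ≤ g j → sum f + (d + e) ≤ sum g
∑-pick₂ {suc m} {f} {g} {i} {j} {d} {e} i≢j f≤g slackᵢ slackⱼ = begin
  sum f + (d + e)                     ≡⟨ cong (_+ (d + e)) (sum-remove f) ⟩
  f i + sum (removeAt f i) + (d + e)  ≡⟨ rearrange (f i) _ d e ⟩
  f i + d + (sum (removeAt f i) + e)  ≤⟨ +-mono-≤ slackᵢ (∑-pick (f≤g ∘ punchIn i) slackⱼ′) ⟩
  g i + sum (removeAt g i)            ≡⟨ sym (sum-remove g) ⟩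
  sum g                               ∎
  where
  open ≤-Reasoning
  rearrange : ∀ a s d e → a + s + (d + e) ≡ a + d + (s + e)
  rearrange = solve-∀
  slackⱼ′ : f (punchIn i (punchOut i≢j)) + e ≤ g (punchIn i (punchOut i≢j))
  slackⱼ′ = subst (λ k → f k + e ≤ g k) (sym (punchIn-punchOut i≢j)) slackⱼ

∑-scale-≤ : ∀ {m} (w h : Fin m → ℕ) {C D} → (∀ i → D ≤ C * h i) →
  sum w * D ≤ C * ∑[ i < m ] (w i * h i)
∑-scale-≤ {m} w h {C} {D} D≤Ch = begin
  sum w * D                   ≡⟨ *-comm (sum w) D ⟩
  D * sum w                   ≡⟨ *-distribˡ-sum D w ⟩
  ∑[ i < m ] (D * w i)        ≤⟨ ∑-mono-≤ (λ i → ≤-trans (≤-reflexive (*-comm D (w i))) (*-monoʳ-≤ (w i) (D≤Ch i))) ⟩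
  ∑[ i < m ] (w i * (C * h i)) ≡⟨ sum-cong-≗ (λ i → swap (w i) C (h i)) ⟩
  ∑[ i < m ] (C * (w i * h i)) ≡⟨ sym (*-distribˡ-sum C (λ i → w i * h i)) ⟩
  C * ∑[ i < m ] (w i * h i)  ∎
  where
  open ≤-Reasoning
  swap : ∀ a c b → a * (c * b) ≡ c * (a * b)
  swap = solve-∀

length-filter-tabulate : ∀ {a} {A : Set a} {m} (h : Fin m → A) (p : A → Bool) →
  length (filter (T? ∘ p) (tabulate h)) ≡ ∑[ i < m ] 𝟙 (p (h i))
length-filter-tabulate {m = zero}  h p = refl
length-filter-tabulate {m = suc m} h p with p (h zero)
... | true  = cong suc (length-filter-tabulate (h ∘ suc) p)
... | false = length-filter-tabulate (h ∘ suc) p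

∣∣≡∑∈ : ∀ {n} (U : Subset n) → ∣ U ∣ ≡ ∑[ x < n ] 𝟙 (does (x ∈? U))
∣∣≡∑∈ []            = refl
∣∣≡∑∈ (inside ∷ U)  = cong suc (∣∣≡∑∈ U)
∣∣≡∑∈ (outside ∷ U) = ∣∣≡∑∈ U

module _ {n} (G : Graph n) where

  adj-sym : ∀ {x y} → adj G x y ≡ true → adj G y x ≡ true
  adj-sym {x} {y} xy = trans (Graph.sym G y x) xy

  adj⇒≢ : ∀ {x y} → adj G x y ≡ true → x ≢ y
  adj⇒≢ {x} xy refl with trans (sym xy) (irrefl G x)
  ... | ()

  ∑-adj≡degree : ∀ x → ∑[ w < n ] 𝟙 (adj G w x) ≡ degree G x
  ∑-adj≡degree x = trans (sum-cong-≗ (λ w → cong 𝟙 (Graph.sym G w x)))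
                         (sym (length-filter-tabulate (λ w → w) (adj G x)))

retarget : ∀ {n} {G H : Graph n} {P Q : Fin n → Set} {k} (c : CliqueIn G P k) →
  (∀ {i j} → adj G (vertex c i) (vertex c j) ≡ true → adj H (vertex c i) (vertex c j) ≡ true) →
  (∀ i → Q (vertex c i)) → CliqueIn H Q k
retarget c adj⇒ inQ = record
  { f = vertex c ; inj = inj c ; adjac = λ i j i≢j → adj⇒ (adjac c i j i≢j) ; inW = inQ }

module _ {n} {G : Graph n} where

  extend : ∀ {P : Fin n → Set} {k} (c : CliqueIn G P k) (x : Fin n) →
    (∀ i → adj G x (vertex c i) ≡ true) → P x → CliqueIn G P (suc k)
  extend {P} {k} c x x-adj Px = record { f = f′ ; inj = inj′ ; adjac = adjac′ ; inW = inW′ }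
    where
    f′ : Fin (suc k) → Fin n
    f′ zero    = x
    f′ (suc i) = vertex c i
    inj′ : ∀ {i j} → f′ i ≡ f′ j → i ≡ j
    inj′ {zero}  {zero}  _ = refl
    inj′ {zero}  {suc j} e = ⊥-elim (adj⇒≢ G (x-adj j) e)
    inj′ {suc i} {zero}  e = ⊥-elim (adj⇒≢ G (x-adj i) (sym e))
    inj′ {suc i} {suc j} e = cong suc (inj c e)
    adjac′ : ∀ i j → i ≢ j → adj G (f′ i) (f′ j) ≡ true
    adjac′ zero    zero    i≢j = ⊥-elim (i≢j refl)
    adjac′ zero    (suc j) _   = x-adj j
    adjac′ (suc i) zero    _   = adj-sym G (x-adj i)
    adjac′ (suc i) (suc j) i≢j = adjac c i j (i≢j ∘ cong suc)
    inW′ : ∀ i → P (f′ i)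
    inW′ zero    = Px
    inW′ (suc i) = inW c i

  link : ∀ {P : Fin n → Set} {k} (c : CliqueIn G P (suc k)) (i : Fin (suc k)) →
    CliqueIn G (λ w → P w × adj G (vertex c i) w ≡ true) k
  link c i = record
    { f     = vertex c ∘ punchIn i
    ; inj   = λ e → punchIn-injective i _ _ (inj c e)
    ; adjac = λ j j′ j≢j′ → adjac c _ _ (j≢j′ ∘ punchIn-injective i _ _)
    ; inW   = λ j → inW c (punchIn i j) , adjac c i (punchIn i j) (punchInᵢ≢i i j ∘ sym)
    }

  nonadjacent-over-clique : ∀ {P : Fin n → Set} {m} {x y} → KFree (2 + m) G → (c : CliqueIn G P m) →
    (∀ i → adj G x (vertex c i) ≡ true) → (∀ i → adj G y (vertex c i) ≡ true) → adj G y x ≡ false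
  nonadjacent-over-clique {x = x} {y} kFree c x-adj y-adj = ¬-not λ yx →
    kFree (extend (extend (retarget c (λ e → e) (λ _ → tt)) x x-adj tt) y (λ { zero → yx ; (suc i) → y-adj i }) tt)

  clique-through : ∀ {H : Graph n} {P : Fin n → Set} {s} z → KFree s G → (c : CliqueIn H P s) →
    (∀ {x y} → x ≢ z → y ≢ z → adj H x y ≡ adj G x y) → ∃ λ i → vertex c i ≡ z
  clique-through z kFree c agree with any? (λ i → vertex c i ≟ z)
  ... | yes found = found
  ... | no absent = ⊥-elim (kFree (retarget c (λ {i} {j} e → trans (sym (agree (avoid i) (avoid j))) e) (λ _ → tt)))
    where
    avoid : ∀ i → vertex c i ≢ z
    avoid i e = absent (i , e)

module _ {n} (G : Graph n) {u v : Fin n} (u≢v : u ≢ v) where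

  addEdge-adj-awayˡ : ∀ {x y} → x ≢ u → y ≢ u → adj (addEdge G u v u≢v) x y ≡ adj G x y
  addEdge-adj-awayˡ {x} {y} x≢u y≢u with x ≟ u | y ≟ u
  ... | yes x≡u | _        = ⊥-elim (x≢u x≡u)
  ... | no _    | yes y≡u  = ⊥-elim (y≢u y≡u)
  ... | no _    | no _     = trans (cong (adj G x y ∨_) (∧-zeroʳ (does (x ≟ v)))) (∨-identityʳ (adj G x y))

  addEdge-adj-awayʳ : ∀ {x y} → x ≢ v → y ≢ v → adj (addEdge G u v u≢v) x y ≡ adj G x y
  addEdge-adj-awayʳ {x} {y} x≢v y≢v with x ≟ v | y ≟ v
  ... | yes x≡v | _        = ⊥-elim (x≢v x≡v)
  ... | no _    | yes y≡v  = ⊥-elim (y≢v y≡v)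
  ... | no _    | no _     =
    trans (cong (adj G x y ∨_) (trans (∨-identityʳ _) (∧-zeroʳ (does (x ≟ u))))) (∨-identityʳ (adj G x y))

CommonNeighbour : ∀ {n} → Graph n → Fin n → Fin n → Fin n → Set
CommonNeighbour G u v w = adj G u w ≡ true × adj G v w ≡ true

commonNeighbourClique : ∀ {n k} (G : Graph n) → MaximalKFree (2 + k) G → ∀ {u v} (u≢v : u ≢ v) →
  adj G u v ≡ false → CliqueIn G (CommonNeighbour G u v) k
commonNeighbourClique G (kFree , saturated) {u} {v} u≢v uv =
  retarget c₂ (λ {i} {j} e → trans (sym (addEdge-adj-awayˡ G u≢v (away-u i) (away-u j))) e) common
  where
  G′ = addEdge G u v u≢v
  c  = saturated u v u≢v uv
  through-u = clique-through u kFree c (addEdge-adj-awayˡ G u≢v)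
  through-v = clique-through v kFree c (addEdge-adj-awayʳ G u≢v)
  iu≢iv : proj₁ through-u ≢ proj₁ through-v
  iu≢iv e = u≢v (trans (sym (proj₂ through-u)) (trans (cong (vertex c) e) (proj₂ through-v)))
  c₂ = link (link c (proj₁ through-u)) (punchOut iu≢iv)
  common′ : ∀ i → CommonNeighbour G′ u v (vertex c₂ i)
  common′ i with inW c₂ i
  ... | (_ , cu) , cv =
    subst (λ x → adj G′ x (vertex c₂ i) ≡ true) (proj₂ through-u) cu ,
    subst (λ x → adj G′ x (vertex c₂ i) ≡ true) (trans (cong (vertex c) (punchIn-punchOut iu≢iv)) (proj₂ through-v)) cv
  away-u : ∀ i → vertex c₂ i ≢ u
  away-u i e = adj⇒≢ G′ (proj₁ (common′ i)) (sym e)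
  away-v : ∀ i → vertex c₂ i ≢ v
  away-v i e = adj⇒≢ G′ (proj₂ (common′ i)) (sym e)
  common : ∀ i → CommonNeighbour G u v (vertex c₂ i)
  common i = trans (sym (addEdge-adj-awayʳ G u≢v u≢v (away-v i))) (proj₁ (common′ i))
           , trans (sym (addEdge-adj-awayˡ G u≢v (u≢v ∘ sym) (away-u i))) (proj₂ (common′ i))

module Exchanges {n} (G : Graph n) (u v : Fin n) (U : Subset n) where

  insideCount : ∀ {k} → CliqueIn G (CommonNeighbour G u v) k → ℕ
  insideCount {k} c = ∑[ i < k ] 𝟙 (does (vertex c i ∈? U))

  Exchange : ∀ {k} → CliqueIn G (CommonNeighbour G u v) (suc k) → Fin (suc k) → Fin n → Set
  Exchange c i w = vertex c i ∈ U × w ∉ U × CommonNeighbour G u v w ×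
                   (∀ j → adj G w (vertex c (punchIn i j)) ≡ true)

  exchange? : ∀ {k} (c : CliqueIn G (CommonNeighbour G u v) (suc k)) → Dec (∃₂ (Exchange c))
  exchange? c = any? λ i → any? λ w →
    (vertex c i ∈? U) ×-dec ¬? (w ∈? U) ×-dec ((adj G u w ≟ᵇ true) ×-dec (adj G v w ≟ᵇ true)) ×-dec
    all? (λ j → adj G w (vertex c (punchIn i j)) ≟ᵇ true)

  exchange : ∀ {k} (c : CliqueIn G (CommonNeighbour G u v) (suc k)) {i w} → Exchange c i w →
    CliqueIn G (CommonNeighbour G u v) (suc k)
  exchange c {i} {w} (_ , _ , common , w-adj) =
    extend (retarget (link c i) (λ e → e) (proj₁ ∘ inW (link c i))) w w-adj common

  insideCount-exchange : ∀ {k} (c : CliqueIn G (CommonNeighbour G u v) (suc k)) {i w} (e : Exchange c i w) →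
    insideCount (exchange c e) < insideCount c
  insideCount-exchange c {i} {w} e@(i∈U , w∉U , _) = begin-strict
    insideCount (exchange c e)       ≡⟨ cong (λ b → 𝟙 b + rest) (dec-false (w ∈? U) w∉U) ⟩
    rest                             <⟨ n<1+n rest ⟩
    1 + rest                         ≡⟨ cong (λ b → 𝟙 b + rest) (dec-true (vertex c i ∈? U) i∈U) ⟨
    𝟙 (does (vertex c i ∈? U)) + rest ≡⟨ sum-remove (λ j → 𝟙 (does (vertex c j ∈? U))) ⟨
    insideCount c                    ∎
    where
    open ≤-Reasoning
    rest = ∑[ j < _ ] 𝟙 (does (vertex c (punchIn i j) ∈? U))

  exchangeAway : ∀ {k} →
    (∀ (c : CliqueIn G (CommonNeighbour G u v) (suc k)) → ¬ ∃₂ (Exchange c) → ∀ i → vertex c i ∉ U) →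
    CliqueIn G (CommonNeighbour G u v) (suc k) → CliqueIn G (λ w → CommonNeighbour G u v w × w ∉ U) (suc k)
  exchangeAway {k} rigid⇒outside c₀ = go (insideCount c₀) c₀ ≤-refl
    where
    go : ∀ fuel (c : CliqueIn G (CommonNeighbour G u v) (suc k)) → insideCount c ≤ fuel →
      CliqueIn G (λ w → CommonNeighbour G u v w × w ∉ U) (suc k)
    go fuel c count≤ with exchange? c
    ... | no rigid = retarget c (λ e → e) (λ i → inW c i , rigid⇒outside c rigid i)
    ... | yes (_ , _ , e) with fuel
    ...   | zero       = ⊥-elim (n≮0 (<-≤-trans (insideCount-exchange c e) count≤))
    ...   | suc fuel′  = go fuel′ (exchange c e) (s≤s⁻¹ (≤-trans (insideCount-exchange c e) count≤))

-- Double counting edges between V and the multiset {u, v} ∪ c ∪ (c ∖ U).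
module Counting {n k} (G : Graph n) (kFree : KFree (3 + k) G) {u v : Fin n} (U : Subset n)
  (c : CliqueIn G (CommonNeighbour G u v) (suc k)) (rigid : ¬ ∃₂ (Exchanges.Exchange G u v U c)) where

  weight : Fin n → ℕ
  weight x = if does (x ∈? U) then 1 else 2

  ω : Fin (suc k) → ℕ
  ω i = weight (vertex c i)

  budget : ℕ
  budget = sum ω

  neighbours : Fin n → ℕ
  neighbours w = 𝟙 (adj G w u) + 𝟙 (adj G w v)

  weightedAdj : Fin n → ℕ
  weightedAdj w = ∑[ i < suc k ] (ω i * 𝟙 (adj G w (vertex c i)))

  weightedDegree : ℕ
  weightedDegree = ∑[ i < suc k ] (ω i * degree G (vertex c i))

  load : Fin n → ℕ
  load w = neighbours w + weightedAdj w

  1≤weight : ∀ x → 1 ≤ weight x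
  1≤weight x with does (x ∈? U)
  ... | true  = ≤-refl
  ... | false = s≤s z≤n

  neighbours≤2 : ∀ w → neighbours w ≤ 2
  neighbours≤2 w = +-mono-≤ (𝟙≤1 (adj G w u)) (𝟙≤1 (adj G w v))

  weightedAdj-≤ : ∀ w i → ω i * 𝟙 (adj G w (vertex c i)) ≤ ω i
  weightedAdj-≤ w i = *𝟙≤ (ω i) _

  neighbours-of-substitute : ∀ {w} i → (∀ j → adj G w (vertex c (punchIn i j)) ≡ true) →
    neighbours w ≤ ω i + 𝟙 (does (w ∈? U))
  neighbours-of-substitute {w} i others with vertex c i ∈? U | w ∈? U
  ... | no _    | _       = ≤-trans (neighbours≤2 w) (m≤m+n 2 _)
  ... | yes _   | yes _   = neighbours≤2 w
  ... | yes i∈U | no w∉U with adj G w u in wu | adj G w v in wv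
  ...   | true  | true  = ⊥-elim (rigid (i , w , i∈U , w∉U , (adj-sym G wu , adj-sym G wv) , others))
  ...   | true  | false = ≤-refl
  ...   | false | _     = 𝟙≤1 _

  load-≤ : ∀ {w s I} → neighbours w ≤ s → weightedAdj w + s ≤ budget + I → load w ≤ budget + I
  load-≤ {w} {s} nbrs≤s h = ≤-trans (+-monoˡ-≤ (weightedAdj w) nbrs≤s) (≤-trans (≤-reflexive (+-comm s _)) h)

  load-bound : ∀ w → load w ≤ budget + 𝟙 (does (w ∈? U))
  load-bound w with any? (λ i → adj G w (vertex c i) ≟ᵇ false)
  ... | no none = load-≤ neighbours≤0 (begin
    weightedAdj w + 0  ≡⟨ +-identityʳ _ ⟩
    weightedAdj w      ≤⟨ ∑-mono-≤ (weightedAdj-≤ w) ⟩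
    budget             ≤⟨ m≤m+n budget _ ⟩
    budget + I         ∎)
    where
    open ≤-Reasoning
    I = 𝟙 (does (w ∈? U))
    dominating : ∀ i → adj G w (vertex c i) ≡ true
    dominating i = ¬-not λ e → none (i , e)
    neighbours≤0 : neighbours w ≤ 0
    neighbours≤0 rewrite nonadjacent-over-clique kFree c (proj₁ ∘ inW c) dominating
                       | nonadjacent-over-clique kFree c (proj₂ ∘ inW c) dominating = z≤n
  ... | yes (i , missᵢ) with any? (λ j → adj G w (vertex c (punchIn i j)) ≟ᵇ false)
  ...   | yes (j , missⱼ) = load-≤ (neighbours≤2 w) (begin
    weightedAdj w + 2                      ≤⟨ +-monoʳ-≤ (weightedAdj w) (+-mono-≤ (1≤weight (vertex c i)) (1≤weight (vertex c (punchIn i j)))) ⟩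
    weightedAdj w + (ω i + ω (punchIn i j)) ≤⟨ ∑-pick₂ (punchInᵢ≢i i j ∘ sym) (weightedAdj-≤ w)
                                                 (*𝟙-false (ω i) missᵢ) (*𝟙-false (ω (punchIn i j)) missⱼ) ⟩
    budget                                 ≤⟨ m≤m+n budget _ ⟩
    budget + I                             ∎)
    where
    open ≤-Reasoning
    I = 𝟙 (does (w ∈? U))
  ...   | no none = load-≤ (neighbours-of-substitute i (λ j → ¬-not λ e → none (j , e))) (begin
    weightedAdj w + (ω i + I)  ≡⟨ +-assoc (weightedAdj w) (ω i) I ⟨
    weightedAdj w + ω i + I    ≤⟨ +-monoˡ-≤ I (∑-pick (weightedAdj-≤ w) (*𝟙-false (ω i) missᵢ)) ⟩
    budget + I                 ∎)
    where
    open ≤-Reasoning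
    I = 𝟙 (does (w ∈? U))

  ∑-load : ∑[ w < n ] load w ≡ degree G u + degree G v + weightedDegree
  ∑-load = begin
    ∑[ w < n ] load w                                                ≡⟨ ∑-distrib-+ neighbours weightedAdj ⟩
    sum neighbours + sum weightedAdj                                 ≡⟨ cong (_+ sum weightedAdj) (∑-distrib-+ (λ w → 𝟙 (adj G w u)) (λ w → 𝟙 (adj G w v))) ⟩
    ∑[ w < n ] 𝟙 (adj G w u) + ∑[ w < n ] 𝟙 (adj G w v) + sum weightedAdj
      ≡⟨ cong₂ (λ x y → x + y + sum weightedAdj) (∑-adj≡degree G u) (∑-adj≡degree G v) ⟩
    degree G u + degree G v + sum weightedAdj                        ≡⟨ cong (degree G u + degree G v +_) ∑-weightedAdj ⟩
    degree G u + degree G v + weightedDegree ∎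
    where
    open ≡-Reasoning
    ∑-weightedAdj : sum weightedAdj ≡ weightedDegree
    ∑-weightedAdj = begin
      sum weightedAdj                                              ≡⟨ ∑-comm (λ w i → ω i * 𝟙 (adj G w (vertex c i))) ⟩
      ∑[ i < suc k ] ∑[ w < n ] (ω i * 𝟙 (adj G w (vertex c i)))     ≡⟨ sum-cong-≗ (λ i → *-distribˡ-sum (ω i) (λ w → 𝟙 (adj G w (vertex c i)))) ⟨
      ∑[ i < suc k ] (ω i * ∑[ w < n ] 𝟙 (adj G w (vertex c i)))     ≡⟨ sum-cong-≗ (λ i → cong (ω i *_) (∑-adj≡degree G (vertex c i))) ⟩
      weightedDegree                   ∎

  ∑-load-≤ : ∑[ w < n ] load w ≤ n * budget + ∣ U ∣
  ∑-load-≤ = begin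
    ∑[ w < n ] load w                                     ≤⟨ ∑-mono-≤ load-bound ⟩
    ∑[ w < n ] (budget + 𝟙 (does (w ∈? U)))                ≡⟨ ∑-distrib-+ (λ _ → budget) (λ w → 𝟙 (does (w ∈? U))) ⟩
    ∑[ w < n ] budget + ∑[ w < n ] 𝟙 (does (w ∈? U))       ≡⟨ cong₂ _+_ (∑-const n budget) (sym (∣∣≡∑∈ U)) ⟩
    n * budget + ∣ U ∣                                      ∎
    where open ≤-Reasoning

  weighted-degree-count : ∀ {C D} → (∀ x → D ≤ C * degree G x) → (2 + budget) * D ≤ C * (n * budget + ∣ U ∣)
  weighted-degree-count {C} {D} D≤ = begin
    (2 + budget) * D                                              ≡⟨ split D budget ⟩
    D + D + budget * D                                            ≤⟨ +-mono-≤ (+-mono-≤ (D≤ u) (D≤ v))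
                                                                        (∑-scale-≤ ω (degree G ∘ vertex c) {C} (D≤ ∘ vertex c)) ⟩
    C * degree G u + C * degree G v + C * weightedDegree
                                                                  ≡⟨ factor C (degree G u) (degree G v) weightedDegree ⟩
    C * (degree G u + degree G v + weightedDegree)
                                                                  ≡⟨ cong (C *_) ∑-load ⟨
    C * ∑[ w < n ] load w                                         ≤⟨ *-monoʳ-≤ C ∑-load-≤ ⟩
    C * (n * budget + ∣ U ∣)                                        ∎
    where
    open ≤-Reasoning
    split : ∀ D B → (2 + B) * D ≡ D + D + B * D
    split = solve-∀
    factor : ∀ C x y z → C * x + C * y + C * z ≡ C * (x + y + z)
    factor = solve-∀

  budget-bound : ∀ {i} → vertex c i ∈ U → budget ≤ 1 + 2 * k
  budget-bound {i} i∈U = s≤s⁻¹ (begin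
    suc budget           ≡⟨ +-comm 1 budget ⟩
    budget + 1           ≤⟨ ∑-pick {g = λ _ → 2} weight≤2 ωᵢ+1≤2 ⟩
    ∑[ j < suc k ] 2     ≡⟨ ∑-const (suc k) 2 ⟩
    suc k * 2            ≡⟨ cong (2 +_) (*-comm k 2) ⟩
    2 + 2 * k            ∎)
    where
    open ≤-Reasoning
    weight≤2 : ∀ j → ω j ≤ 2
    weight≤2 j with does (vertex c j ∈? U)
    ... | true  = s≤s z≤n
    ... | false = ≤-refl
    ωᵢ+1≤2 : ω i + 1 ≤ 2
    ωᵢ+1≤2 = subst (λ b → (if b then 1 else 2) + 1 ≤ 2) (sym (dec-true (vertex c i ∈? U) i∈U)) ≤-refl

-- p = 2r − 5; both sides are multiplied by b(2r − 3), which clears the denominators of the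
-- degree bound ((2r − 5)/(2r − 3) + a/b)·n.
degree-excess : ∀ {p B n a b U} → B ≤ p → b * U < a * n →
  b * (2 + p) * (n * B + U) < (2 + B) * (b * p * n + a * (2 + p) * n)
degree-excess {B = B} {n} {a} {b} {U} B≤p bU<an with m≤n⇒∃[o]m+o≡n B≤p
... | d , refl = begin-strict
  b * (2 + p) * (n * B + U)                   ≡⟨ lhs b B d n U ⟩
  X + (2 + p) * (b * U)                       <⟨ +-monoʳ-< X (*-monoʳ-< (2 + p) bU<an) ⟩
  X + (2 + p) * (a * n)                       ≤⟨ +-monoʳ-≤ X (≤-trans (m≤n*m _ (2 + B)) (m≤m+n _ _)) ⟩
  X + ((2 + B) * ((2 + p) * (a * n)) + 2 * (b * n * d)) ≡⟨ rhs a b B d n ⟩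
  (2 + B) * (b * p * n + a * (2 + p) * n)      ∎
  where
  open ≤-Reasoning
  p = B + d
  X = b * (2 + p) * (n * B)
  lhs : ∀ b B d n U → b * (2 + (B + d)) * (n * B + U) ≡ b * (2 + (B + d)) * (n * B) + (2 + (B + d)) * (b * U)
  lhs = solve-∀
  rhs : ∀ a b B d n → b * (2 + (B + d)) * (n * B) + ((2 + B) * ((2 + (B + d)) * (a * n)) + 2 * (b * n * d))
                    ≡ (2 + B) * (b * (B + d) * n + a * (2 + (B + d)) * n)
  rhs = solve-∀

2r∸5 : ∀ t → 2 * (3 + t) ∸ 5 ≡ 1 + 2 * t
2r∸5 t = cong (_∸ 5) (double t)
  where
  double : ∀ t → 2 * (3 + t) ≡ 5 + (1 + 2 * t)
  double = solve-∀

2r∸3 : ∀ t → 2 * (3 + t) ∸ 3 ≡ 2 + (1 + 2 * t)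
2r∸3 t = cong (_∸ 3) (double t)
  where
  double : ∀ t → 2 * (3 + t) ≡ 3 + (2 + (1 + 2 * t))
  double = solve-∀

proposition2p2 : (r n a b : ℕ) → 3 ≤ r → 1 ≤ a → 1 ≤ b →
    (G : Graph n) → MaximalKFree r G →
    (∀ v → b * (2 * r ∸ 5) * n + a * (2 * r ∸ 3) * n ≤ b * (2 * r ∸ 3) * degree G v) →
    (u v : Fin n) → u ≢ v → adj G u v ≡ false →
    (U : Subset n) → b * ∣ U ∣ < a * n →
    CliqueIn G (λ w → adj G u w ≡ true × adj G v w ≡ true × w ∉ U) (r ∸ 2)
proposition2p2 (suc (suc (suc t))) n a b (s≤s (s≤s (s≤s _))) _ _ G maximal minDegree u v u≢v uv U small
  rewrite 2r∸5 t | 2r∸3 t =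
  retarget avoiding (λ e → e) (λ i → let ((inᵤ , inᵥ) , ∉U) = inW avoiding i in inᵤ , inᵥ , ∉U)
  where
  open Exchanges G u v U
  rigid⇒outside : ∀ c → ¬ ∃₂ (Exchange c) → ∀ i → vertex c i ∉ U
  rigid⇒outside c rigid i i∈U =
    <-irrefl refl (≤-<-trans (weighted-degree-count {C = b * (2 + (1 + 2 * t))} minDegree)
                             (degree-excess {n = n} {a} {b} {∣ U ∣} (budget-bound i∈U) small))
    where open Counting G (proj₁ maximal) U c rigid
  avoiding = exchangeAway rigid⇒outside (commonNeighbourClique G maximal u≢v uv)
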